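{- For all formulas $A,B$: if $A\vdash B$ is provable in $\mathbf{CNL_4^2}$, then $A\vDash_{\mathbf{CNL_4^2}}B$.
   Context: Formulas are built from a countable set $PV$ of variables with binary $\wedge,\vee$ and unary ${\sim}$; ${\sim}^{n}A$ denotes $n$-fold application of ${\sim}$. Semantics: $\mathscr U=\{\mathbf T,\mathbf{TU},\mathbf{FU},\mathbf F\}$ ordered as the lattice $4\mathcal Q$ with $\mathbf T$ top, $\mathbf F$ bottom, $\mathbf{TU},\mathbf{FU}$ incomparable; $f_{\sim}$: $\mathbf T\mapsto\mathbf{TU}$, $\mathbf{TU}\mapsto\mathbf F$, $\mathbf F\mapsto\mathbf{FU}$, $\mathbf{FU}\mapsto\mathbf T$; designated set $\mathcal D=\{\mathbf T,\mathbf{TU}\}$. A $\mathbf{CNL_4^2}$-valuation is a map $PV\to\mathscr U$ extended to formulas with $\wedge,\vee$ as meet/join in $4\mathcal Q$ and ${\sim}$ as $f_{\sim}$. $A\vDash_{\mathbf{CNL_4^2}}B$ means every $\mathbf{CNL_4^2}$-valuation $v$ with $v(A)\in\mathcal D$ has $v(B)\in\mathcal D$. The calculus $\mathbf{CNL_4^2}$ (on sequents $A\vdash B$) has axiom schemata (a1) $A\wedge B\vdash A$; (a2) $A\wedge B\vdash B$; (a3) $B\vdash A\vee B$; (a4) $A\vdash A\vee B$; (a5) $A\vdash{\sim}^{4}A$; (a6) ${\sim}^{4}A\vdash A$; (a7) ${\sim}A\wedge{\sim}B\vdash{\sim}(A\wedge B)$; (a8) ${\sim}(A\vee B)\vdash{\sim}A\vee{\sim}B$;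 (a9) $A\wedge{\sim}^{2}A\vdash B$; (a10) $A\wedge(B\vee C)\vdash(A\wedge B)\vee(A\wedge C)$; (b1) ${\sim}(A\wedge B)\vdash{\sim}A\wedge{\sim}B$; (b2) ${\sim}A\vee{\sim}B\vdash{\sim}(A\vee B)$; and rules (r1) $A\vdash B$, $B\vdash C$ / $A\vdash C$; (r2) $A\vdash B$, $A\vdash C$ / $A\vdash B\wedge C$; (r3) $A\vdash C$, $B\vdash C$ / $A\vee B\vdash C$; (r4) $A\vdash B$ / ${\sim}^{2}B\vdash{\sim}^{2}A$. A proof is a finite list of sequents each an axiom or obtained from earlier ones by a rule; $A\vdash B$ is provable if it is the last item of some proof. -}

module Defs where

open import Data.Nat using (ℕ; zero; suc)

PV : Set
PV = ℕ

infixr 6 _∧_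
infixr 5 _∨_

data Formula : Set where
  var : PV → Formula
  _∧_ : Formula → Formula → Formula
  _∨_ : Formula → Formula → Formula
  ∼_  : Formula → Formula

∼^ : ℕ → Formula → Formula
∼^ zero    A = A
∼^ (suc n) A = ∼ (∼^ n A)

-- The four truth values, lattice 4Q: T top, F bottom, TU and FU incomparable.
data V4 : Set where
  T TU FU F : V4

_⊓_ : V4 → V4 → V4
T  ⊓ y  = y
F  ⊓ y  = F
TU ⊓ T  = TU
TU ⊓ TU = TU
TU ⊓ FU = F
TU ⊓ F  = F
FU ⊓ T  = FU
FU ⊓ TU = F
FU ⊓ FU = FU
FU ⊓ F  = F

_⊔_ : V4 → V4 → V4
T  ⊔ y  = T
F  ⊔ y  = y
TU ⊔ T  = T
TU ⊔ TU = TU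
TU ⊔ FU = T
TU ⊔ F  = TU
FU ⊔ T  = T
FU ⊔ TU = T
FU ⊔ FU = FU
FU ⊔ F  = FU

f∼ : V4 → V4
f∼ T  = TU
f∼ TU = F
f∼ F  = FU
f∼ FU = T

data Designated : V4 → Set where
  desT  : Designated T
  desTU : Designated TU

Valuation : Set
Valuation = PV → V4

⟦_⟧ : Formula → Valuation → V4
⟦ var p ⟧ v = v p
⟦ A ∧ B ⟧ v = ⟦ A ⟧ v ⊓ ⟦ B ⟧ v
⟦ A ∨ B ⟧ v = ⟦ A ⟧ v ⊔ ⟦ B ⟧ v
⟦ ∼ A ⟧   v = f∼ (⟦ A ⟧ v)

_⊨_ : Formula → Formula → Set
A ⊨ B = (v : Valuation) → Designated (⟦ A ⟧ v) → Designated (⟦ B ⟧ v)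

-- provability of the sequent A ⊢ B in the calculus CNL₄²
-- (inductive closure of the axioms under the rules = existence of a finite proof)
infix 2 _⊢_
data _⊢_ : Formula → Formula → Set where
  a1  : ∀ {A B} → A ∧ B ⊢ A
  a2  : ∀ {A B} → A ∧ B ⊢ B
  a3  : ∀ {A B} → B ⊢ A ∨ B
  a4  : ∀ {A B} → A ⊢ A ∨ B
  a5  : ∀ {A} → A ⊢ ∼^ 4 A
  a6  : ∀ {A} → ∼^ 4 A ⊢ A
  a7  : ∀ {A B} → ∼ A ∧ ∼ B ⊢ ∼ (A ∧ B)
  a8  : ∀ {A B} → ∼ (A ∨ B) ⊢ ∼ A ∨ ∼ B
  a9  : ∀ {A B} → A ∧ ∼^ 2 A ⊢ B
  a10 : ∀ {A B C} → A ∧ (B ∨ C) ⊢ (A ∧ B) ∨ (A ∧ C)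
  b1  : ∀ {A B} → ∼ (A ∧ B) ⊢ ∼ A ∧ ∼ B
  b2  : ∀ {A B} → ∼ A ∨ ∼ B ⊢ ∼ (A ∨ B)
  r1  : ∀ {A B C} → A ⊢ B → B ⊢ C → A ⊢ C
  r2  : ∀ {A B C} → A ⊢ B → A ⊢ C → A ⊢ B ∧ C
  r3  : ∀ {A B C} → A ⊢ C → B ⊢ C → A ∨ B ⊢ C
  r4  : ∀ {A B} → A ⊢ B → ∼^ 2 B ⊢ ∼^ 2 A

{-# OPTIONS --safe #-}
module Submission where

open import Data.Empty using (⊥-elim)
open import Data.Product using (_×_; _,_; proj₁; proj₂; uncurry)
open import Data.Product.Function.NonDependent.Propositional using (_×-⇔_)
open import Data.Sum using (_⊎_; inj₁; inj₂; [_,_]; map)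
open import Data.Sum.Function.Propositional using (_⊎-⇔_)
open import Function using (_∘_; _⇔_; mk⇔; Equivalence)
open import Function.Properties.Equivalence using (⇔-setoid)
open import Level using (0ℓ)
import Relation.Binary.Reasoning.Setoid as SetoidReasoning
open import Relation.Binary.PropositionalEquality using (_≡_; refl; cong; subst; sym)
open import Relation.Nullary using (¬_)
open import Defs

open Equivalence using (to; from)
module ⇔-Reasoning = SetoidReasoning (⇔-setoid 0ℓ)

-- Soundness is checked rule by rule, and every check is a fact about how the
-- designated values 𝒟 = {T, TU} = ↑TU sit in 4Q.  Since TU is an atom of the
-- Boolean lattice 4Q, ↑TU is a prime filter, so ∧ and ∨ are read classically.
-- The double negation f∼ ∘ f∼ swaps 𝒟 with its complement {FU, F}, so ∼²
-- behaves as classical negation (giving a9 and contraposition r4).  Finally a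
-- single f∼ is designated exactly when the lattice automorphism of 4Q exchanging
-- TU and FU lands in 𝒟, which transports the prime-filter property to the
-- De Morgan laws a7, a8, b1, b2.

⊓-designated : ∀ x y → Designated (x ⊓ y) ⇔ (Designated x × Designated y)
⊓-designated x y = mk⇔ (split x y) (uncurry join)
  where
  split : ∀ x y → Designated (x ⊓ y) → Designated x × Designated y
  split T  y  d = desT , d
  split TU T  _ = desTU , desT
  split TU TU _ = desTU , desTU
  split TU FU ()
  split TU F  ()
  split FU T  ()
  split FU TU ()
  split FU FU ()
  split FU F  ()
  split F  y  ()

  join : ∀ {x y} → Designated x → Designated y → Designated (x ⊓ y)
  join desT  dy    = dy
  join desTU desT  = desTU
  join desTU desTU = desTU

⊔-designated : ∀ x y → Designated (x ⊔ y) ⇔ (Designated x ⊎ Designated y)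
⊔-designated x y = mk⇔ (split x y) [ left y , right x ]
  where
  split : ∀ x y → Designated (x ⊔ y) → Designated x ⊎ Designated y
  split T  y  _ = inj₁ desT
  split TU y  _ = inj₁ desTU
  split FU T  _ = inj₂ desT
  split FU TU _ = inj₂ desTU
  split FU FU ()
  split FU F  ()
  split F  y  d = inj₂ d

  left : ∀ {x} y → Designated x → Designated (x ⊔ y)
  left y  desT  = desT
  left T  desTU = desT
  left TU desTU = desTU
  left FU desTU = desT
  left F  desTU = desTU

  right : ∀ x {y} → Designated y → Designated (x ⊔ y)
  right T  _     = desT
  right TU desT  = desT
  right TU desTU = desTU
  right FU desT  = desT
  right FU desTU = desT
  right F  d     = d

f∼∘f∼-designated : ∀ x → Designated (f∼ (f∼ x)) ⇔ (¬ Designated x)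
f∼∘f∼-designated x = mk⇔ (reject x) (accept x)
  where
  reject : ∀ x → Designated (f∼ (f∼ x)) → ¬ Designated x
  reject T  ()
  reject TU ()

  accept : ∀ x → ¬ Designated x → Designated (f∼ (f∼ x))
  accept T  nd = ⊥-elim (nd desT)
  accept TU nd = ⊥-elim (nd desTU)
  accept FU _  = desTU
  accept F  _  = desT

f∼-period-4 : ∀ x → f∼ (f∼ (f∼ (f∼ x))) ≡ x
f∼-period-4 T  = refl
f∼-period-4 TU = refl
f∼-period-4 FU = refl
f∼-period-4 F  = refl

swap : V4 → V4
swap T  = T
swap TU = FU
swap FU = TU
swap F  = F

swap-⊓ : ∀ x y → swap (x ⊓ y) ≡ swap x ⊓ swap y
swap-⊓ T  y  = refl
swap-⊓ F  y  = refl
swap-⊓ TU T  = refl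
swap-⊓ TU TU = refl
swap-⊓ TU FU = refl
swap-⊓ TU F  = refl
swap-⊓ FU T  = refl
swap-⊓ FU TU = refl
swap-⊓ FU FU = refl
swap-⊓ FU F  = refl

swap-⊔ : ∀ x y → swap (x ⊔ y) ≡ swap x ⊔ swap y
swap-⊔ T  y  = refl
swap-⊔ F  y  = refl
swap-⊔ TU T  = refl
swap-⊔ TU TU = refl
swap-⊔ TU FU = refl
swap-⊔ TU F  = refl
swap-⊔ FU T  = refl
swap-⊔ FU TU = refl
swap-⊔ FU FU = refl
swap-⊔ FU F  = refl

f∼-designated : ∀ x → Designated (f∼ x) ⇔ Designated (swap x)
f∼-designated x = mk⇔ (forth x) (back x)
  where
  forth : ∀ x → Designated (f∼ x) → Designated (swap x)
  forth T  _ = desT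
  forth FU _ = desTU

  back : ∀ x → Designated (swap x) → Designated (f∼ x)
  back T  _ = desTU
  back FU _ = desT

f∼-⊓-designated : ∀ x y →
  Designated (f∼ (x ⊓ y)) ⇔ (Designated (f∼ x) × Designated (f∼ y))
f∼-⊓-designated x y = begin
  Designated (f∼ (x ⊓ y))                     ≈⟨ f∼-designated (x ⊓ y) ⟩
  Designated (swap (x ⊓ y))                   ≡⟨ cong Designated (swap-⊓ x y) ⟩
  Designated (swap x ⊓ swap y)                ≈⟨ ⊓-designated (swap x) (swap y) ⟩
  (Designated (swap x) × Designated (swap y)) ≈⟨ f∼-designated x ×-⇔ f∼-designated y ⟨
  (Designated (f∼ x) × Designated (f∼ y))     ∎
  where open ⇔-Reasoning

f∼-⊔-designated : ∀ x y →
  Designated (f∼ (x ⊔ y)) ⇔ (Designated (f∼ x) ⊎ Designated (f∼ y))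
f∼-⊔-designated x y = begin
  Designated (f∼ (x ⊔ y))                     ≈⟨ f∼-designated (x ⊔ y) ⟩
  Designated (swap (x ⊔ y))                   ≡⟨ cong Designated (swap-⊔ x y) ⟩
  Designated (swap x ⊔ swap y)                ≈⟨ ⊔-designated (swap x) (swap y) ⟩
  (Designated (swap x) ⊎ Designated (swap y)) ≈⟨ f∼-designated x ⊎-⇔ f∼-designated y ⟨
  (Designated (f∼ x) ⊎ Designated (f∼ y))     ∎
  where open ⇔-Reasoning

⊓-⊔-distribˡ-designated : ∀ x y z →
  Designated (x ⊓ (y ⊔ z)) → Designated ((x ⊓ y) ⊔ (x ⊓ z))
⊓-⊔-distribˡ-designated x y z d =
  let d-x , d-y⊔z = to (⊓-designated x (y ⊔ z)) d
      with-x : ∀ w → Designated w → Designated (x ⊓ w)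
      with-x w d-w = from (⊓-designated x w) (d-x , d-w)
  in  from (⊔-designated (x ⊓ y) (x ⊓ z))
           (map (with-x y) (with-x z) (to (⊔-designated y z) d-y⊔z))

mainTheorem5 : (A B : Formula) → A ⊢ B → A ⊨ B
mainTheorem5 _ _ (a1 {A} {B}) v = proj₁ ∘ to (⊓-designated (⟦ A ⟧ v) (⟦ B ⟧ v))
mainTheorem5 _ _ (a2 {A} {B}) v = proj₂ ∘ to (⊓-designated (⟦ A ⟧ v) (⟦ B ⟧ v))
mainTheorem5 _ _ (a3 {A} {B}) v = from (⊔-designated (⟦ A ⟧ v) (⟦ B ⟧ v)) ∘ inj₂
mainTheorem5 _ _ (a4 {A} {B}) v = from (⊔-designated (⟦ A ⟧ v) (⟦ B ⟧ v)) ∘ inj₁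
mainTheorem5 _ _ (a5 {A}) v = subst Designated (sym (f∼-period-4 (⟦ A ⟧ v)))
mainTheorem5 _ _ (a6 {A}) v = subst Designated (f∼-period-4 (⟦ A ⟧ v))
mainTheorem5 _ _ (a7 {A} {B}) v =
  from (f∼-⊓-designated (⟦ A ⟧ v) (⟦ B ⟧ v)) ∘ to (⊓-designated _ _)
mainTheorem5 _ _ (a8 {A} {B}) v =
  from (⊔-designated _ _) ∘ to (f∼-⊔-designated (⟦ A ⟧ v) (⟦ B ⟧ v))
mainTheorem5 _ _ (a9 {A}) v d =
  let d-A , d-∼∼A = to (⊓-designated (⟦ A ⟧ v) _) d
  in  ⊥-elim (to (f∼∘f∼-designated (⟦ A ⟧ v)) d-∼∼A d-A)
mainTheorem5 _ _ (a10 {A} {B} {C}) v =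
  ⊓-⊔-distribˡ-designated (⟦ A ⟧ v) (⟦ B ⟧ v) (⟦ C ⟧ v)
mainTheorem5 _ _ (b1 {A} {B}) v =
  from (⊓-designated _ _) ∘ to (f∼-⊓-designated (⟦ A ⟧ v) (⟦ B ⟧ v))
mainTheorem5 _ _ (b2 {A} {B}) v =
  from (f∼-⊔-designated (⟦ A ⟧ v) (⟦ B ⟧ v)) ∘ to (⊔-designated _ _)
mainTheorem5 _ _ (r1 p q) v = mainTheorem5 _ _ q v ∘ mainTheorem5 _ _ p v
mainTheorem5 _ _ (r2 {B = B} {C} p q) v d =
  from (⊓-designated (⟦ B ⟧ v) (⟦ C ⟧ v))
       (mainTheorem5 _ _ p v d , mainTheorem5 _ _ q v d)
mainTheorem5 _ _ (r3 {A} {B} p q) v =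
  [ mainTheorem5 _ _ p v , mainTheorem5 _ _ q v ] ∘ to (⊔-designated (⟦ A ⟧ v) (⟦ B ⟧ v))
mainTheorem5 _ _ (r4 {A} {B} p) v d =
  from (f∼∘f∼-designated (⟦ A ⟧ v))
       (to (f∼∘f∼-designated (⟦ B ⟧ v)) d ∘ mainTheorem5 _ _ p v)
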